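{- Let $\mathcal{F}$ be a filter on $\omega$ and consider the game $\mathfrak{G}(\mathrm{Fr},\omega,\mathcal{F}^*)$. Then the game is determined, and player I has a winning strategy if and only if $\mathcal{F}=\mathrm{Fr}$ if and only if player II has no winning strategy.
   Context: A filter on $\omega$ is a family $\mathcal{F}\subseteq\mathcal{P}(\omega)$ closed under finite intersections and supersets and containing all cofinite subsets of $\omega$; $\mathrm{Fr}$ is the filter of cofinite sets. $\mathcal{F}^+=\{X\subseteq\omega: X\cap Y\text{ is infinite for all }Y\in\mathcal{F}\}$ and $\mathcal{F}^*=\mathcal{P}(\omega)\setminus\mathcal{F}^+$. The game $\mathfrak{G}(\mathrm{Fr},\omega,\mathcal{Z})$: at each stage $k<\omega$, player I chooses a cofinite set $X_k$, and II responds with some $n_k\in X_k$; II wins the play if $\{n_k:k\in\omega\}\in\mathcal{Z}$, otherwise I wins. A strategy is a function of previous moves; it is winning if it wins every play following it. Determined means one of the players has a winning strategy. -}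

module Defs where

open import Level using (0ℓ; Lift) renaming (suc to lsuc)
open import Data.Nat using (ℕ; _≤_; _<_)
open import Data.Product using (Σ; _×_; _,_; proj₁; ∃)
open import Data.List using (List; []; _∷_)
open import Relation.Nullary using (¬_)
open import Data.Sum using (_⊎_)
import Data.Sum
open import Relation.Binary.PropositionalEquality using (_≡_)

Subset : Set₁
Subset = ℕ → Set

_∩_ : Subset → Subset → Subset
(X ∩ Y) n = X n × Y n

_⊆_ : Subset → Subset → Set
X ⊆ Y = ∀ n → X n → Y n

Finite : Subset → Set
Finite X = Σ ℕ λ N → ∀ n → X n → n < N

Infinite : Subset → Set
Infinite X = ¬ Finite X

Cofinite : Subset → Set
Cofinite X = Σ ℕ λ N → ∀ n → N ≤ n → X n

Family : Set₂
Family = Subset → Set₁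

Fr : Family
Fr X = Lift (lsuc 0ℓ) (Cofinite X)

-- Filter on ω as in the paper (no properness required).
record IsFilter (F : Family) : Set₁ where
  field
    ∩-closed    : ∀ X Y → F X → F Y → F (X ∩ Y)
    ⊇-closed    : ∀ X Y → F X → X ⊆ Y → F Y
    cofinite∈   : ∀ X → Cofinite X → F X

_≐_ : Family → Family → Set₁
F ≐ G = ∀ X → (F X → G X) × (G X → F X)

_⁺ : Family → Family
(F ⁺) X = ∀ Y → F Y → Infinite (X ∩ Y)

_* : Family → Family
(F *) X = ¬ (F ⁺) X

CofSet : Set₁
CofSet = Σ Subset Cofinite

-- A history: the finite list of completed rounds (X_k , n_k),
-- most recent round first.
History : Set₁
History = List (CofSet × ℕ)

StratI : Set₁
StratI = History → CofSet

StratII : Set₁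
StratII = History → (X : CofSet) → Σ ℕ (λ n → proj₁ X n)

rangeOf : (ℕ → ℕ) → Subset
rangeOf ns n = Σ ℕ λ k → ns k ≡ n

histI : StratI → (ℕ → ℕ) → ℕ → History
histI σ ns ℕ.zero    = []
histI σ ns (ℕ.suc k) = (σ (histI σ ns k) , ns k) ∷ histI σ ns k

LegalAgainstI : StratI → (ℕ → ℕ) → Set
LegalAgainstI σ ns = ∀ k → proj₁ (σ (histI σ ns k)) (ns k)

histII : StratII → (ℕ → CofSet) → ℕ → History
movesII : StratII → (ℕ → CofSet) → ℕ → ℕ
histII τ xs ℕ.zero    = []
histII τ xs (ℕ.suc k) = (xs k , movesII τ xs k) ∷ histII τ xs k
movesII τ xs k = proj₁ (τ (histII τ xs k) (xs k))

-- II wins a play iff {n_k} ∈ 𝒵.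
WinningI : Family → StratI → Set₁
WinningI Z σ = ∀ ns → LegalAgainstI σ ns → ¬ Z (rangeOf ns)

WinningII : Family → StratII → Set₁
WinningII Z τ = ∀ xs → Z (rangeOf (movesII τ xs))

IHasWS : Family → Set₁
IHasWS Z = Σ StratI (WinningI Z)

IIHasWS : Family → Set₁
IIHasWS Z = Σ StratII (WinningII Z)

Determined : Family → Set₁
Determined Z = IHasWS Z ⊎ IIHasWS Z

-- If some Y ∈ F is not cofinite, II wins by always answering outside Y: every
-- cofinite move of I meets the complement of Y, and the resulting range misses
-- Y, so it is not F-positive. Otherwise F = Fr, and I wins by playing the tail
-- [k, ∞) at stage k: the answers are then unbounded and meet every cofinite set
-- infinitely often, so their range is F-positive. A single play against both
-- strategies shows that I and II cannot both win.
module Submission where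

open import Defs
open import Axiom.ExcludedMiddle using (ExcludedMiddle)
open import Level using (0ℓ; lift; lower)
open import Data.Nat using (ℕ; zero; suc; _≤_; _<_; _⊔_)
open import Data.Nat.Properties using (m≤m⊔n; m≤n⊔m; ≤-trans; <-≤-trans; <-irrefl)
open import Data.Product using (Σ; _×_; _,_; proj₁; proj₂)
open import Data.Sum using (_⊎_; inj₁; inj₂)
open import Data.Empty using (⊥-elim)
open import Data.List using ([]; _∷_; length)
open import Relation.Nullary using (¬_; yes; no)
open import Relation.Binary.PropositionalEquality using (_≡_; refl; sym; subst; cong)
open import Function.Bundles using (_⇔_; mk⇔)

cofinite-⊇ : {X Y : Subset} → Cofinite X → X ⊆ Y → Cofinite Y
cofinite-⊇ (N , X-tail) X⊆Y = N , λ n N≤n → X⊆Y n (X-tail n N≤n)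

⊈⇒∃∖ : ExcludedMiddle 0ℓ → {X Y : Subset} → ¬ X ⊆ Y → Σ ℕ λ n → X n × ¬ Y n
⊈⇒∃∖ em {X} {Y} X⊈Y with em {Σ ℕ λ n → X n × ¬ Y n}
... | yes witness = witness
... | no no-witness = ⊥-elim (X⊈Y X⊆Y)
  where
  X⊆Y : X ⊆ Y
  X⊆Y n Xn with em {Y n}
  ... | yes Yn = Yn
  ... | no ¬Yn = ⊥-elim (no-witness (n , Xn , ¬Yn))

cofinite-meets-∁ : ExcludedMiddle 0ℓ → {Y : Subset} → ¬ Cofinite Y →
  (X : CofSet) → Σ ℕ λ n → proj₁ X n × ¬ Y n
cofinite-meets-∁ em Y-not-cof (X , X-cof) = ⊈⇒∃∖ em (λ X⊆Y → Y-not-cof (cofinite-⊇ X-cof X⊆Y))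

disjoint⇒* : {F : Family} {X Y : Subset} → F Y → (∀ n → X n → ¬ Y n) → (F *) X
disjoint⇒* {Y = Y} Y∈F X∩Y≡∅ X∈F⁺ = X∈F⁺ Y Y∈F (0 , λ n (Xn , Yn) → ⊥-elim (X∩Y≡∅ n Xn Yn))

unbounded-range-meets-cofinite : {ns : ℕ → ℕ} {Y : Subset} →
  (∀ k → k ≤ ns k) → Cofinite Y → Infinite (rangeOf ns ∩ Y)
unbounded-range-meets-cofinite {ns} k≤ns (N , Y-tail) (M , bound) =
  <-irrefl refl (<-≤-trans ns[k]<M (≤-trans (m≤n⊔m N M) (k≤ns k)))
  where
  k : ℕ
  k = N ⊔ M
  ns[k]<M : ns k < M
  ns[k]<M = bound (ns k) ((k , refl) , Y-tail (ns k) (≤-trans (m≤m⊔n N M) (k≤ns k)))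

module _ (σ : StratI) (τ : StratII) where

  history : ℕ → History
  history zero    = []
  history (suc k) = (σ (history k) , proj₁ (τ (history k) (σ (history k)))) ∷ history k

  movesI : ℕ → CofSet
  movesI k = σ (history k)

  histII-movesI : ∀ k → histII τ movesI k ≡ history k
  histII-movesI zero = refl
  histII-movesI (suc k) rewrite histII-movesI k = refl

  histI-movesII : ∀ k → histI σ (movesII τ movesI) k ≡ history k
  histI-movesII zero = refl
  histI-movesII (suc k) rewrite histI-movesII k | histII-movesI k = refl

  movesII-legal : LegalAgainstI σ (movesII τ movesI)
  movesII-legal k = subst (λ h → proj₁ (σ h) (movesII τ movesI k))
    (sym (histI-movesII k)) (proj₂ (τ (histII τ movesI k) (movesI k)))

¬-bothWin : (Z : Family) → IHasWS Z → ¬ IIHasWS Z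
¬-bothWin Z (σ , σ-wins) (τ , τ-wins) =
  σ-wins (movesII τ (movesI σ τ)) (movesII-legal σ τ) (τ-wins (movesI σ τ))

length-histI : (σ : StratI) (ns : ℕ → ℕ) (k : ℕ) → length (histI σ ns k) ≡ k
length-histI σ ns zero    = refl
length-histI σ ns (suc k) = cong suc (length-histI σ ns k)

playTail : StratI
playTail h = (λ n → length h ≤ n) , length h , λ n p → p

playTail-wins : {F : Family} → (∀ Y → F Y → Cofinite Y) → WinningI (F *) playTail
playTail-wins F⊆Fr ns legal range∈F* = range∈F* λ Y Y∈F →
  unbounded-range-meets-cofinite (λ k → subst (_≤ ns k) (length-histI playTail ns k) (legal k))
    (F⊆Fr Y Y∈F)

avoid : ExcludedMiddle 0ℓ → {Y : Subset} → ¬ Cofinite Y → StratII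
avoid em Y-not-cof h X = let (n , Xn , _) = cofinite-meets-∁ em Y-not-cof X in n , Xn

avoid-wins : (em : ExcludedMiddle 0ℓ) {F : Family} {Y : Subset} → F Y →
  (Y-not-cof : ¬ Cofinite Y) → WinningII (F *) (avoid em Y-not-cof)
avoid-wins em {Y = Y} Y∈F Y-not-cof xs = disjoint⇒* Y∈F λ n (k , eq) →
  subst (λ m → ¬ Y m) eq (proj₂ (proj₂ (cofinite-meets-∁ em Y-not-cof (xs k))))

nonCofiniteMember? : (∀ {ℓ} → ExcludedMiddle ℓ) → (F : Family) →
  (Σ Subset λ Y → F Y × ¬ Cofinite Y) ⊎ (∀ Y → F Y → Cofinite Y)
nonCofiniteMember? em F with em {P = Σ Subset λ Y → F Y × ¬ Cofinite Y}
... | yes member = inj₁ member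
... | no no-member = inj₂ F⊆Fr
  where
  F⊆Fr : ∀ Y → F Y → Cofinite Y
  F⊆Fr Y Y∈F with em {P = Cofinite Y}
  ... | yes Y-cof = Y-cof
  ... | no Y-not-cof = ⊥-elim (no-member (Y , Y∈F , Y-not-cof))

≐Fr : {F : Family} → IsFilter F → (∀ Y → F Y → Cofinite Y) → F ≐ Fr
≐Fr F-filter F⊆Fr X = (λ X∈F → lift (F⊆Fr X X∈F)) , λ X∈Fr → IsFilter.cofinite∈ F-filter X (lower X∈Fr)

theorem2p4 : (∀ {ℓ} → ExcludedMiddle ℓ) →
    (F : Family) → IsFilter F →
      Determined (F *)
      × (IHasWS (F *) ⇔ (F ≐ Fr))
      × ((F ≐ Fr) ⇔ (¬ IIHasWS (F *)))
theorem2p4 em F F-filter with nonCofiniteMember? em F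
... | inj₁ (Y , Y∈F , Y-not-cof) =
  inj₂ II-wins ,
  mk⇔ (λ I-wins → ⊥-elim (¬-bothWin (F *) I-wins II-wins)) F≐Fr-absurd ,
  mk⇔ F≐Fr-absurd (λ ¬II-wins → ⊥-elim (¬II-wins II-wins))
  where
  II-wins : IIHasWS (F *)
  II-wins = avoid em Y-not-cof , avoid-wins em Y∈F Y-not-cof
  F≐Fr-absurd : ∀ {A : Set₁} → F ≐ Fr → A
  F≐Fr-absurd F≐Fr = ⊥-elim (Y-not-cof (lower (proj₁ (F≐Fr Y) Y∈F)))
... | inj₂ F⊆Fr =
  inj₁ I-wins ,
  mk⇔ (λ _ → ≐Fr F-filter F⊆Fr) (λ _ → I-wins) ,
  mk⇔ (λ _ → ¬-bothWin (F *) I-wins) (λ _ → ≐Fr F-filter F⊆Fr)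
  where
  I-wins : IHasWS (F *)
  I-wins = playTail , playTail-wins F⊆Fr
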